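{- Let $S=(a_h)_{h\in\mathbb{Z}}$ be a complete folding sequence, let $n\in\mathbb{N}$, and let $T=(a_{h+1},\dots,a_{h+2^n-1})$ for some $h\in E_n(S)$. Then an $(n+2)$-folding sequence is a subword of $S$ if and only if it can be written in the form $(\overline{T},-\zeta,T,\eta,\overline{T},\zeta,T)$ or $(T,-\zeta,\overline{T},\eta,T,\zeta,\overline{T})$ with $\zeta,\eta\in\{+1,-1\}$.
   Context: All sequences take values in $\{+1,-1\}$. For $S=(a_1,\dots,a_n)$ write $\overline{S}=(-a_n,\dots,-a_1)$. The $n$-folding sequences are defined recursively: the only $0$-folding sequence is the empty sequence, and the $(n+1)$-folding sequences are exactly $(\overline{S},+1,S)$ and $(\overline{S},-1,S)$ with $S$ an $n$-folding sequence. A finite sequence $(u_1,\dots,u_m)$ is a subword of a sequence $(b_k)$ if there is $h$ with $u_k=b_{k+h}$ for $1\le k\le m$. A complete folding sequence is a sequence $(a_k)_{k\in\mathbb{Z}}$ each finite subword of which is a subword of some $n$-folding sequence. For a complete folding sequence $S=(a_h)$ and each $n\in\mathbb{N}$ there is $h_n\in\mathbb{Z}$ with $a_{h_n+k2^{n+1}}=(-1)^k a_{h_n}$ for all $k\in\mathbb{Z}$; the set $E_n(S)=h_n+2^n\mathbb{Z}$ does not depend on the choice of $h_n$. -}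

module Defs where

open import Data.Nat as ℕ using (ℕ; zero; suc; _≤_; _^_; _∸_)
open import Data.Integer as ℤ using (ℤ; ∣_∣)
open import Data.Integer.Divisibility using (_∣_)
open import Data.List using (List; []; _∷_; _++_; map; reverse; length; take; drop)
open import Data.Product using (Σ; ∃; _×_; _,_)
open import Data.Sign as Sg using (Sign; opposite)
open import Relation.Binary.PropositionalEquality using (_≡_)

-- Signs ±1 are represented by Data.Sign.Sign ('Sg.+' = +1, 'Sg.-' = -1).

bar : List Sign → List Sign
bar S = reverse (map opposite S)

data Folding : ℕ → List Sign → Set where
  fold0 : Folding zero []
  foldS : ∀ {n S} (s : Sign) → Folding n S → Folding (suc n) (bar S ++ (s ∷ S))

SubwordL : List Sign → List Sign → Set
SubwordL u b = ∃ λ (h : ℕ) → (h ℕ.+ length u ≤ length b) × (take (length u) (drop h b) ≡ u)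

segment : (ℤ → Sign) → ℤ → ℕ → List Sign
segment a h zero = []
segment a h (suc m) = a h ∷ segment a (h ℤ.+ ℤ.+ 1) m

SubwordZ : List Sign → (ℤ → Sign) → Set
SubwordZ u a = ∃ λ (h : ℤ) → segment a h (length u) ≡ u

CompleteFolding : (ℤ → Sign) → Set
CompleteFolding a = ∀ (u : List Sign) → SubwordZ u a →
  ∃ λ (n : ℕ) → ∃ λ (S : List Sign) → Folding n S × SubwordL u S

negPow : ℕ → Sign → Sign
negPow zero s = s
negPow (suc k) s = opposite (negPow k s)

IsHn : (ℤ → Sign) → ℕ → ℤ → Set
IsHn a n h' = ∀ (k : ℤ) → a (h' ℤ.+ k ℤ.* ℤ.+ (2 ^ suc n)) ≡ negPow ∣ k ∣ (a h')

-- E_n(S) = h_n + 2^n ℤ  (union over valid choices of h_n; independent of the choice)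
InE : (ℤ → Sign) → ℕ → ℤ → Set
InE a n h = ∃ λ (h' : ℤ) → IsHn a n h' × (ℤ.+ (2 ^ n) ∣ (h ℤ.- h'))

module Submission where

-- In a finite M-folding sequence S, a position c with 2^N ∣ c + 1 is a fold
-- point: S is antisymmetric about c up to radius 2^N - 1 (fold-antisymmetric).
-- Hence a sign change S_q ≠ S_{q+2^(n+1)} only happens at level-n fold points
-- (flip-at-fold), and the blocks of length 2^n - 1 starting at multiples of
-- 2^n all agree up to reversal-negation, ≈± (aligned-blocks).  Embedding finite
-- windows of a into folding sequences, the blocks of a after positions
-- congruent to such sign changes are related (aligned-related); h is such a
-- position.  Forward: an (n+2)-folding U is Form W t s, and the -t … t in it
-- marks a fold point followed by W, so W ≈± T.  Backward: a contains an
-- (n+5)-folding subword, which contains every Form (G or Ḡ) ζ η over its block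
-- G (a finite check on the 32 five-fold templates), and G ≈± T as before.

open import Defs
open import Data.Nat using (ℕ; _^_; _∸_; _+_)
open import Data.Integer as ℤ using (ℤ)
open import Data.List using (List; []; _∷_; _++_)
open import Data.Product using (∃; _×_)
open import Data.Sum using (_⊎_)
open import Data.Sign using (Sign; opposite)
open import Function.Bundles using (_⇔_; mk⇔)
open import Relation.Binary.PropositionalEquality using (_≡_)

open import Data.Nat as ℕ using (zero; suc; _*_; _≤_; _<_; z≤n; s≤s)
open import Data.Nat.Properties
open import Data.Nat.Divisibility
  using (_∣_; _∣?_; divides; ∣-refl; ∣m∣n⇒∣m+n; n∣m*n; ∣⇒≤; ∣m+n∣m⇒∣n; m%n≡0⇒n∣m)
open import Data.Nat.DivMod using (_%_; _/_; m≡m%n+[m/n]*n; m%n<n)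
open import Data.Nat.Tactic.RingSolver using (solve-∀)
import Data.Integer.Properties as ℤP
open import Data.Integer.Divisibility using () renaming (_∣_ to _∣ℤ_)
import Data.Integer.Divisibility.Signed as ℤ∣
import Data.Integer.Tactic.RingSolver as ℤSolver
open import Data.List using (map; reverse; length; take; drop; concatMap; [_])
open import Data.List.Properties
  using (reverse-++; reverse-involutive; reverse-map; map-++; length-reverse; length-map; length-++;
         ++-assoc; ++-identityʳ; unfold-reverse; length-take; length-drop; take-all; ∷-injective; concatMap-++)
open import Data.List.Relation.Binary.Infix.Heterogeneous using (Infix; MkView; toView)
open import Data.List.Relation.Binary.Infix.Heterogeneous.Properties using (infix?)
open import Data.List.Relation.Binary.Pointwise using (Pointwise-≡⇒≡)
open import Data.Product using (_,_; proj₁; proj₂)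
import Data.Sum as Sum
open import Data.Sum using (inj₁; inj₂)
open import Data.Sum.Properties using (≡-dec)
import Data.Sign as Sg
import Data.Sign.Properties as SgP
open import Data.Sign.Properties using (opposite-involutive; s≢opposite[s])
open import Function using (_∘_)
open import Relation.Binary using (tri<; tri≈; tri>)
open import Relation.Binary.PropositionalEquality
  using (refl; sym; trans; cong; cong₂; subst; subst₂; _≢_; module ≡-Reasoning)
open import Relation.Nullary using (Dec; yes; no; ¬_; contradiction)
open import Relation.Nullary.Decidable using (from-yes; map′; _×-dec_)

-- Total indexing of sign lists; out-of-range positions read as +, but every
-- use below is within range.
at : List Sign → ℕ → Sign
at []       _       = Sg.+
at (x ∷ xs) zero    = x
at (x ∷ xs) (suc i) = at xs i

at-++ˡ : ∀ (xs ys : List Sign) {i} → i < length xs → at (xs ++ ys) i ≡ at xs i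
at-++ˡ (x ∷ xs) ys {zero}  _       = refl
at-++ˡ (x ∷ xs) ys {suc i} (s≤s p) = at-++ˡ xs ys p

at-++ʳ : ∀ (xs ys : List Sign) i → at (xs ++ ys) (length xs + i) ≡ at ys i
at-++ʳ []       ys i = refl
at-++ʳ (x ∷ xs) ys i = at-++ʳ xs ys i

at-drop : ∀ k (xs : List Sign) i → at (drop k xs) i ≡ at xs (k + i)
at-drop zero    xs       i = refl
at-drop (suc k) []       i = refl
at-drop (suc k) (x ∷ xs) i = at-drop k xs i

at-take : ∀ k (xs : List Sign) {i} → i < k → at (take k xs) i ≡ at xs i
at-take (suc k) []       _       = refl
at-take (suc k) (x ∷ xs) {zero}  _       = refl
at-take (suc k) (x ∷ xs) {suc i} (s≤s p) = at-take k xs p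

at-map : ∀ (xs : List Sign) i → i < length xs → at (map opposite xs) i ≡ opposite (at xs i)
at-map (x ∷ xs) zero    _       = refl
at-map (x ∷ xs) (suc i) (s≤s p) = at-map xs i p

at-reverse : ∀ (ys : List Sign) i k → i + suc k ≡ length ys → at (reverse ys) i ≡ at ys k
at-reverse [] zero    k ()
at-reverse [] (suc i) k ()
at-reverse (y ∷ ys) i zero eq rewrite unfold-reverse y ys = begin
  at (reverse ys ++ [ y ]) i                      ≡⟨ cong (at (reverse ys ++ [ y ])) i≡ ⟩
  at (reverse ys ++ [ y ]) (length (reverse ys) + 0) ≡⟨ at-++ʳ (reverse ys) [ y ] 0 ⟩
  y                                               ∎
  where
  open ≡-Reasoning
  i≡ : i ≡ length (reverse ys) + 0
  i≡ = trans (suc-injective (trans (+-comm 1 i) eq)) (sym (trans (+-identityʳ _) (length-reverse ys)))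
at-reverse (y ∷ ys) i (suc k) eq rewrite unfold-reverse y ys =
  trans (at-++ˡ (reverse ys) [ y ] i<) (at-reverse ys i k eq′)
  where
  eq′ : i + suc k ≡ length ys
  eq′ = suc-injective (trans (sym (+-suc i (suc k))) eq)
  i< : i < length (reverse ys)
  i< = subst (i <_) (trans eq′ (sym (length-reverse ys))) (m<m+n i (s≤s z≤n))

at-bar : ∀ (xs : List Sign) i k → i + suc k ≡ length xs → at (bar xs) i ≡ opposite (at xs k)
at-bar xs i k eq =
  trans (at-reverse (map opposite xs) i k (trans eq (sym (length-map opposite xs))))
        (at-map xs k (subst (k <_) eq (m≤n+m (suc k) i)))

list-ext : ∀ (xs ys : List Sign) → length xs ≡ length ys →
           (∀ i → i < length xs → at xs i ≡ at ys i) → xs ≡ ys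
list-ext []       []       _  _ = refl
list-ext (x ∷ xs) (y ∷ ys) eq f =
  cong₂ _∷_ (f 0 (s≤s z≤n)) (list-ext xs ys (suc-injective eq) (λ i p → f (suc i) (s≤s p)))

length-bar : ∀ (xs : List Sign) → length (bar xs) ≡ length xs
length-bar xs = trans (length-reverse (map opposite xs)) (length-map opposite xs)

bar-++ : ∀ (xs ys : List Sign) → bar (xs ++ ys) ≡ bar ys ++ bar xs
bar-++ xs ys = trans (cong reverse (map-++ opposite xs ys)) (reverse-++ (map opposite xs) (map opposite ys))

bar-bar : ∀ (xs : List Sign) → bar (bar xs) ≡ xs
bar-bar xs = begin
  reverse (map opposite (reverse (map opposite xs))) ≡⟨ cong reverse (reverse-map opposite (map opposite xs)) ⟩
  reverse (reverse (map opposite (map opposite xs))) ≡⟨ reverse-involutive _ ⟩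
  map opposite (map opposite xs)                     ≡⟨ opposite-twice xs ⟩
  xs                                                 ∎
  where
  open ≡-Reasoning
  opposite-twice : ∀ (ys : List Sign) → map opposite (map opposite ys) ≡ ys
  opposite-twice []       = refl
  opposite-twice (y ∷ ys) = cong₂ _∷_ (opposite-involutive y) (opposite-twice ys)

bar-fold : ∀ (xs : List Sign) s → bar (bar xs ++ s ∷ xs) ≡ bar xs ++ opposite s ∷ xs
bar-fold xs s = begin
  bar (bar xs ++ [ s ] ++ xs)           ≡⟨ bar-++ (bar xs) ([ s ] ++ xs) ⟩
  bar ([ s ] ++ xs) ++ bar (bar xs)     ≡⟨ cong₂ _++_ (bar-++ [ s ] xs) (bar-bar xs) ⟩
  (bar xs ++ [ opposite s ]) ++ xs      ≡⟨ ++-assoc (bar xs) [ opposite s ] xs ⟩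
  bar xs ++ opposite s ∷ xs             ∎
  where open ≡-Reasoning

infix 4 _≈±_

_≈±_ : List Sign → List Sign → Set
U ≈± V = U ≡ V ⊎ U ≡ bar V

≈±-refl : ∀ {U} → U ≈± U
≈±-refl = inj₁ refl

≈±-bar : ∀ {U V} → U ≈± V → bar U ≈± V
≈±-bar {V = V} (inj₁ refl) = inj₂ refl
≈±-bar {V = V} (inj₂ refl) = inj₁ (bar-bar V)

≈±-sym : ∀ {U V} → U ≈± V → V ≈± U
≈±-sym (inj₁ refl)       = inj₁ refl
≈±-sym {V = V} (inj₂ refl) = inj₂ (sym (bar-bar V))

≈±-trans : ∀ {U V W} → U ≈± V → V ≈± W → U ≈± W
≈±-trans (inj₁ refl) q = q
≈±-trans (inj₂ refl) q = ≈±-bar q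

-- The length of an n-folding sequence.
width : ℕ → ℕ
width n = 2 ^ n ∸ 1

double : ∀ n → 2 ^ suc n ≡ 2 ^ n + 2 ^ n
double n = cong (2 ^ n +_) (+-identityʳ (2 ^ n))

suc-width : ∀ n → suc (width n) ≡ 2 ^ n
suc-width n with 2 ^ n | m^n>0 2 n
... | suc k | _ = refl

length-unfold : ∀ S s → length (bar S ++ s ∷ S) ≡ length S + suc (length S)
length-unfold S s = trans (length-++ (bar S)) (cong (_+ suc (length S)) (length-bar S))

fold-suc-length : ∀ {n S} → Folding n S → suc (length S) ≡ 2 ^ n
fold-suc-length fold0 = refl
fold-suc-length {suc n} (foldS {S = S} s f) = begin
  suc (length (bar S ++ s ∷ S))          ≡⟨ cong suc (length-unfold S s) ⟩
  suc (length S) + suc (length S)        ≡⟨ cong₂ _+_ (fold-suc-length f) (trans (fold-suc-length f) (sym (+-identityʳ _))) ⟩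
  2 ^ n + (2 ^ n + 0)                    ∎
  where open ≡-Reasoning

fold-length : ∀ {n S} → Folding n S → length S ≡ width n
fold-length f = cong (_∸ 1) (fold-suc-length f)

fold-bar : ∀ {n S} → Folding n S → Folding n (bar S)
fold-bar fold0 = fold0
fold-bar (foldS {S = S} s f) = subst (Folding _) (sym (bar-fold S s)) (foldS (opposite s) f)

fold-≈± : ∀ {n U V} → Folding n V → U ≈± V → Folding n U
fold-≈± f (inj₁ refl) = f
fold-≈± f (inj₂ refl) = fold-bar f

Form : List Sign → Sign → Sign → List Sign
Form W t s = bar W ++ opposite t ∷ W ++ s ∷ bar W ++ t ∷ W

folding-form : ∀ {n U} → Folding (suc (suc n)) U → ∃ λ W → ∃ λ t → ∃ λ s → Folding n W × U ≡ Form W t s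
folding-form (foldS s (foldS {S = W} t fW)) = W , t , s , fW , (begin
  bar (bar W ++ t ∷ W) ++ s ∷ (bar W ++ t ∷ W)         ≡⟨ cong (_++ s ∷ (bar W ++ t ∷ W)) (bar-fold W t) ⟩
  (bar W ++ opposite t ∷ W) ++ s ∷ (bar W ++ t ∷ W)    ≡⟨ ++-assoc (bar W) (opposite t ∷ W) _ ⟩
  Form W t s                                           ∎)
  where open ≡-Reasoning

fold-prefix : ∀ {M S} → Folding M S → ∀ {N} → N ≤ M → Folding N (take (width N) S)
fold-prefix {S = S} f {N} N≤M with m≤n⇒m<n∨m≡n N≤M
... | inj₂ refl = subst (Folding N) (sym (take-all (width N) S (≤-reflexive (fold-length f)))) f
fold-prefix (foldS {S = S} s f) {N} N≤M | inj₁ (s≤s N≤M′) =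
  subst (Folding N) (sym (take-++ˡ (bar S) (s ∷ S) fits)) (fold-prefix (fold-bar f) N≤M′)
  where
  fits : width N ≤ length (bar S)
  fits = subst (width N ≤_) (sym (trans (length-bar S) (fold-length f))) (∸-monoˡ-≤ 1 (^-monoʳ-≤ 2 N≤M′))
  take-++ˡ : ∀ (xs ys : List Sign) {k} → k ≤ length xs → take k (xs ++ ys) ≡ take k xs
  take-++ˡ xs       ys {zero}  _       = refl
  take-++ˡ (x ∷ xs) ys {suc k} (s≤s p) = cong (x ∷_) (take-++ˡ xs ys p)

-- Antisymmetry of folding sequences about their fold points

at-left : ∀ S s i k → i + suc k ≡ length S → at (bar S ++ s ∷ S) i ≡ opposite (at S k)
at-left S s i k eq = trans (at-++ˡ (bar S) (s ∷ S) i<) (at-bar S i k eq)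
  where
  i< : i < length (bar S)
  i< = subst (i <_) (trans eq (sym (length-bar S))) (m<m+n i (s≤s z≤n))

at-right : ∀ S s j → at (bar S ++ s ∷ S) (suc (length S + j)) ≡ at S j
at-right S s j = subst (λ p → at (bar S ++ s ∷ S) p ≡ at S j)
  (trans (+-suc _ j) (cong (λ l → suc (l + j)) (length-bar S))) (at-++ʳ (bar S) (s ∷ S) (suc j))

-- The three positional cases of fold-point antisymmetry in S′ = (S̄, s, S),
-- according to whether the centre c = m + d lies left of, on, or right of s.
module _ (S : List Sign) (s : Sign) where
  private
    S′ = bar S ++ s ∷ S
    L = length S

  antisym-centre : ∀ m d → m + suc d ≡ L → at S′ (m + suc d + suc d) ≡ opposite (at S′ m)
  antisym-centre m d c≡L = begin
    at S′ (m + suc d + suc d)    ≡⟨ cong (at S′) (trans (+-suc (m + suc d) d) (cong (λ c → suc (c + d)) c≡L)) ⟩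
    at S′ (suc (L + d))          ≡⟨ at-right S s d ⟩
    at S d                       ≡⟨ sym (opposite-involutive _) ⟩
    opposite (opposite (at S d)) ≡⟨ cong opposite (sym (at-left S s m d c≡L)) ⟩
    opposite (at S′ m)           ∎
    where open ≡-Reasoning

  -- Left of s, the mirror image in S of the centre is r + d.
  antisym-left : ∀ m d r → at S (r + d + d) ≡ opposite (at S r) → suc (m + d) + (d + r) ≡ L →
                 at S′ (m + d + d) ≡ opposite (at S′ m)
  antisym-left m d r inner L≡ = begin
    at S′ (m + d + d)                       ≡⟨ at-left S s (m + d + d) r (trans (e₁ m d r) L≡) ⟩
    opposite (at S r)                       ≡⟨ cong opposite (sym (opposite-involutive _)) ⟩
    opposite (opposite (opposite (at S r))) ≡⟨ cong (opposite ∘ opposite) (sym inner) ⟩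
    opposite (opposite (at S (r + d + d)))  ≡⟨ cong opposite (sym (at-left S s m (r + d + d) (trans (e₂ m d r) L≡))) ⟩
    opposite (at S′ m)                      ∎
    where
    open ≡-Reasoning
    e₁ : ∀ m d r → m + d + d + suc r ≡ suc (m + d) + (d + r)
    e₁ = solve-∀
    e₂ : ∀ m d r → m + suc (r + d + d) ≡ suc (m + d) + (d + r)
    e₂ = solve-∀

  -- Right of s, the centre is shifted by L + 1.
  antisym-right : ∀ m d r → at S (r + d + d) ≡ opposite (at S r) → m ≡ suc (L + r) →
                  at S′ (m + d + d) ≡ opposite (at S′ m)
  antisym-right m d r inner refl = begin
    at S′ (suc (L + r) + d + d)   ≡⟨ cong (at S′) (e L r d) ⟩
    at S′ (suc (L + (r + d + d))) ≡⟨ at-right S s (r + d + d) ⟩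
    at S (r + d + d)              ≡⟨ inner ⟩
    opposite (at S r)             ≡⟨ cong opposite (sym (at-right S s r)) ⟩
    opposite (at S′ (suc (L + r))) ∎
    where
    open ≡-Reasoning
    e : ∀ L r d → suc (L + r) + d + d ≡ suc (L + (r + d + d))
    e = solve-∀

below-divisor : ∀ {N k d} → 2 ^ N ∣ suc k → d < 2 ^ N → ∃ λ r → k ≡ d + r
below-divisor {N} {k} {d} ∣k d< = k ∸ d , sym (m+[n∸m]≡n (≤-pred (<-≤-trans d< (∣⇒≤ ∣k))))

power-<-cancel : ∀ {N M} → 2 ^ N < 2 ^ suc M → N ≤ M
power-<-cancel {N} {M} lt with N ≤? M
... | yes N≤M = N≤M
... | no N≰M = contradiction (^-monoʳ-≤ 2 (≰⇒> N≰M)) (<⇒≱ lt)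

power-dvd : ∀ {N M k} → 2 ^ N ∣ suc k → suc k < 2 ^ suc M → 2 ^ N ∣ 2 ^ M
power-dvd {N} {M} N∣k k< with m≤n⇒∃[o]m+o≡n (power-<-cancel {N} {M} (≤-<-trans (∣⇒≤ N∣k) k<))
... | o , refl = divides (2 ^ o) (trans (^-distribˡ-+-* 2 N o) (*-comm (2 ^ N) (2 ^ o)))

inner-fold-level : ∀ {M S N c} → Folding (suc M) S → 2 ^ N ∣ suc c → c < length S → 2 ^ N ∣ 2 ^ M
inner-fold-level {M} {S} {N} {c} f c∣ c< = power-dvd {N} {M} c∣ (subst (suc c <_) (fold-suc-length f) (s≤s c<))

-- By induction on the folding: if c is not the middle of (S̄, s, S), the next
-- level-N fold point lies beyond m + 2d, so both entries fall in the same half.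
fold-antisymmetric : ∀ {M S} → Folding M S → ∀ N m d → 2 ^ N ∣ suc (m + d) → 0 < d → d < 2 ^ N →
                     m + d + d < length S → at S (m + d + d) ≡ opposite (at S m)
fold-antisymmetric {suc M} (foldS {S = S} s f) N m d c∣ 0<d d< bound with <-cmp (m + d) (length S)
... | tri≈ _ c≡L _ with d | 0<d
...   | suc d′ | _ = antisym-centre S s m d′ c≡L
fold-antisymmetric {suc M} (foldS {S = S} s f) N m d c∣ 0<d d< bound | tri< c<L _ _
  with m≤n⇒∃[o]m+o≡n c<L
... | k , L≡ with ∣m+n∣m⇒∣n (subst (2 ^ N ∣_) 2^M≡ (inner-fold-level {N = N} (foldS s f) c∣ (≤-<-trans (m≤m+n _ d) bound))) c∣
  where
  2^M≡ : 2 ^ M ≡ suc (m + d) + suc k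
  2^M≡ = trans (sym (fold-suc-length f)) (trans (cong suc (sym L≡)) (sym (+-suc (suc (m + d)) k)))
...   | k∣ with below-divisor {N} k∣ d<
...     | r , refl = antisym-left S s m d r inner L≡
  where
  e : ∀ m d r → suc (r + d + d) + m ≡ suc (m + d) + (d + r)
  e = solve-∀
  inner : at S (r + d + d) ≡ opposite (at S r)
  inner = fold-antisymmetric f N r d (subst (λ x → 2 ^ N ∣ suc x) (+-comm d r) k∣) 0<d d<
            (subst (suc (r + d + d) ≤_) (trans (e m d r) L≡) (m≤m+n _ m))
fold-antisymmetric {suc M} (foldS {S = S} s f) N m d c∣ 0<d d< bound | tri> _ _ L<c
  with m≤n⇒∃[o]m+o≡n L<c
... | k , c≡ with ∣m+n∣m⇒∣n (subst (2 ^ N ∣_) c+1≡ c∣) (inner-fold-level {N = N} (foldS s f) c∣ (≤-<-trans (m≤m+n _ d) bound))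
  where
  c+1≡ : suc (m + d) ≡ 2 ^ M + suc k
  c+1≡ = trans (cong suc (sym c≡)) (trans (sym (+-suc (suc (length S)) k)) (cong (_+ suc k) (fold-suc-length f)))
...   | k∣ with below-divisor {N} k∣ d<
...     | r , refl = antisym-right S s m d r inner m≡
  where
  L = length S
  e₁ : ∀ L r d → suc L + (d + r) ≡ suc (L + r) + d
  e₁ = solve-∀
  e₂ : ∀ L r d → suc (suc (L + r) + d + d) ≡ suc L + suc (r + d + d)
  e₂ = solve-∀
  m≡ : m ≡ suc (L + r)
  m≡ = +-cancelʳ-≡ d m (suc (L + r)) (trans (sym c≡) (e₁ L r d))
  inner : at S (r + d + d) ≡ opposite (at S r)
  inner = fold-antisymmetric f N r d (subst (λ x → 2 ^ N ∣ suc x) (+-comm d r) k∣) 0<d d<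
            (+-cancelˡ-≤ (suc L) (suc (r + d + d)) L (subst₂ _≤_ (trans (cong (λ x → suc (x + d + d)) m≡) (e₂ L r d))
              (trans (length-unfold S s) (+-comm L (suc L))) bound))

blockAt : ℕ → List Sign → ℕ → List Sign
blockAt n S P = take (width n) (drop P S)

at-blockAt : ∀ n S P {i} → i < width n → at (blockAt n S P) i ≡ at S (P + i)
at-blockAt n S P {i} i< = trans (at-take (width n) (drop P S) i<) (at-drop P S i)

length-take-drop : ∀ m P (S : List Sign) → P + m ≤ length S → length (take m (drop P S)) ≡ m
length-take-drop m P S fits = trans (length-take m (drop P S)) (m≤n⇒m⊓n≡m
  (subst (m ≤_) (sym (length-drop P S)) (subst (_≤ length S ∸ P) (m+n∸m≡n P m) (∸-monoˡ-≤ P fits))))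

length-blockAt : ∀ n S P → P + width n ≤ length S → length (blockAt n S P) ≡ width n
length-blockAt n S P = length-take-drop (width n) P S

module _ {M S} (f : Folding M S) (n : ℕ) where
  private
    X = 2 ^ n
    instance
      X-nonzero : ℕ.NonZero X
      X-nonzero = m^n≢0 2 n

  -- Off the level-n fold points, S has period 2^(n+1): the reflections about
  -- the next two fold points to the right of q compose to a translation.
  period-off-folds : ∀ q → ¬ (X ∣ suc q) → q + (X + X) < length S → at S (q + (X + X)) ≡ at S q
  period-off-folds q ¬∣ bound with suc q % X | m%n<n (suc q) X | m≡m%n+[m/n]*n (suc q) X | m%n≡0⇒n∣m (suc q) X
  ... | zero  | _  | _  | ∣q = contradiction (∣q refl) ¬∣
  ... | suc r | r< | q≡ | _ with m≤n⇒∃[o]m+o≡n r<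
  ...   | k , rk≡ = begin
    at S (q + (X + X))                       ≡⟨ cong (at S) (sym q₂≡) ⟩
    at S (q + suc k + suc k + suc r + suc r) ≡⟨ fold-antisymmetric f n q₁ (suc r) ∣₂ (s≤s z≤n) r<X (subst (_< length S) (sym q₂≡) bound) ⟩
    opposite (at S q₁)                       ≡⟨ cong opposite (fold-antisymmetric f n q (suc k) ∣₁ (s≤s z≤n) k<X q₁<) ⟩
    opposite (opposite (at S q))             ≡⟨ opposite-involutive _ ⟩
    at S q                                   ∎
    where
    open ≡-Reasoning
    c = suc q / X
    q₁ = q + suc k + suc k
    X≡ : X ≡ suc r + suc k
    X≡ = trans (sym rk≡) (sym (+-suc (suc r) k))
    e₁ : ∀ r k c X → suc r + c * X + suc k ≡ (suc r + suc k) + c * X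
    e₁ = solve-∀
    e₂ : ∀ r k c X → suc r + c * X + suc k + suc k + suc r ≡ (suc r + suc k) + ((suc r + suc k) + c * X)
    e₂ = solve-∀
    e₃ : ∀ q r k → q + suc k + suc k + suc r + suc r ≡ q + ((suc r + suc k) + (suc r + suc k))
    e₃ = solve-∀
    -- the fold points q + (k+1) and q₁ + (r+1) are multiples of X, minus one
    ∣₁ : X ∣ suc (q + suc k)
    ∣₁ = divides (suc c) (trans (cong (_+ suc k) q≡) (trans (e₁ r k c X) (cong (_+ c * X) (sym X≡))))
    ∣₂ : X ∣ suc (q₁ + suc r)
    ∣₂ = divides (suc (suc c)) (trans (cong (λ x → x + suc k + suc k + suc r) q≡)
           (trans (e₂ r k c X) (cong (λ y → y + (y + c * X)) (sym X≡))))
    q₂≡ : q + suc k + suc k + suc r + suc r ≡ q + (X + X)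
    q₂≡ = trans (e₃ q r k) (cong (λ y → q + (y + y)) (sym X≡))
    k<X : suc k < X
    k<X = subst (suc k <_) (sym X≡) (m<n+m (suc k) (s≤s z≤n))
    r<X : suc r < X
    r<X = subst (suc r <_) (sym X≡) (m<m+n (suc r) (s≤s z≤n))
    q₁< : q₁ < length S
    q₁< = ≤-<-trans (≤-trans (+-mono-≤ (+-monoʳ-≤ q (<⇒≤ k<X)) (<⇒≤ k<X)) (≤-reflexive (+-assoc q X X))) bound

  flip-at-fold : ∀ q → q + 2 ^ suc n < length S → at S (q + 2 ^ suc n) ≢ at S q → X ∣ suc q
  flip-at-fold q bound flip with X ∣? suc q
  ... | yes ∣q = ∣q
  ... | no ¬∣q = contradiction (subst (λ k → at S (q + k) ≡ at S q) (sym (double n))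
                   (period-off-folds q ¬∣q (subst (λ k → q + k < length S) (double n) bound))) flip

  across-fold : ∀ P i k → X ∣ P → i + suc k ≡ width n → P + X + i < length S →
                at S (P + X + i) ≡ opposite (at S (P + k))
  across-fold P i k ∣P w≡ bound =
    subst (λ p → at S p ≡ opposite (at S (P + k))) mirror≡
      (fold-antisymmetric f n (P + k) (suc i) fold∣ (s≤s z≤n) i+1<X (subst (_< length S) (sym mirror≡) bound))
    where
    e₁ : ∀ P k i → P + k + suc i + suc i ≡ P + suc (i + suc k) + i
    e₁ = solve-∀
    e₂ : ∀ P k i → suc (P + k + suc i) ≡ P + suc (i + suc k)
    e₂ = solve-∀
    X≡ : suc (i + suc k) ≡ X
    X≡ = trans (cong suc w≡) (suc-width n)
    mirror≡ : P + k + suc i + suc i ≡ P + X + i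
    mirror≡ = trans (e₁ P k i) (cong (λ y → P + y + i) X≡)
    fold∣ : X ∣ suc (P + k + suc i)
    fold∣ = subst (X ∣_) (sym (trans (e₂ P k i) (cong (P +_) X≡))) (∣m∣n⇒∣m+n ∣P ∣-refl)
    i+1<X : suc i < X
    i+1<X = subst (suc i <_) X≡ (s≤s (subst (suc i ≤_) (sym (+-suc i k)) (s≤s (m≤m+n i k))))

  adjacent-blocks : ∀ P → X ∣ P → P + X + width n ≤ length S → blockAt n S (P + X) ≡ bar (blockAt n S P)
  adjacent-blocks P ∣P fits = list-ext _ _ lengths (λ i i< → entry i (subst (i <_) length-after i<))
    where
    fits′ : P + width n ≤ length S
    fits′ = ≤-trans (+-monoˡ-≤ (width n) (m≤m+n P X)) fits
    length-after : length (blockAt n S (P + X)) ≡ width n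
    length-after = length-blockAt n S (P + X) fits
    length-before : length (blockAt n S P) ≡ width n
    length-before = length-blockAt n S P fits′
    lengths : length (blockAt n S (P + X)) ≡ length (bar (blockAt n S P))
    lengths = trans length-after (sym (trans (length-bar (blockAt n S P)) length-before))
    entry : ∀ i → i < width n → at (blockAt n S (P + X)) i ≡ at (bar (blockAt n S P)) i
    entry i i< with m≤n⇒∃[o]m+o≡n i<
    ... | k , ik≡ = begin
      at (blockAt n S (P + X)) i      ≡⟨ at-blockAt n S (P + X) i< ⟩
      at S (P + X + i)                ≡⟨ across-fold P i k ∣P w≡ (<-≤-trans (+-monoʳ-< (P + X) i<) fits) ⟩
      opposite (at S (P + k))         ≡⟨ cong opposite (sym (at-blockAt n S P (subst (k <_) w≡ (m≤n+m (suc k) i)))) ⟩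
      opposite (at (blockAt n S P) k) ≡⟨ sym (at-bar (blockAt n S P) i k (trans w≡ (sym length-before))) ⟩
      at (bar (blockAt n S P)) i      ∎
      where
      open ≡-Reasoning
      w≡ : i + suc k ≡ width n
      w≡ = trans (+-suc i k) ik≡

  blocks-along : ∀ P → X ∣ P → ∀ j → P + j * X + width n ≤ length S →
                 blockAt n S (P + j * X) ≈± blockAt n S P
  blocks-along P ∣P zero    _    = subst (λ Q → blockAt n S Q ≈± blockAt n S P) (sym (+-identityʳ P)) ≈±-refl
  blocks-along P ∣P (suc j) fits =
    subst (λ Q → blockAt n S Q ≈± blockAt n S P) (sym (step≡ P j X))
      (subst (_≈± blockAt n S P) (sym (adjacent-blocks (P + j * X) ∣Q fits′))
        (≈±-bar (blocks-along P ∣P j (≤-trans (+-monoˡ-≤ (width n) (m≤m+n (P + j * X) X)) fits′))))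
    where
    step≡ : ∀ P j X → P + (X + j * X) ≡ P + j * X + X
    step≡ = solve-∀
    fits′ : P + j * X + X + width n ≤ length S
    fits′ = subst (λ Q → Q + width n ≤ length S) (step≡ P j X) fits
    ∣Q : X ∣ P + j * X
    ∣Q = ∣m∣n⇒∣m+n ∣P (n∣m*n j)

  blocks-ordered : ∀ P Q → X ∣ P → X ∣ Q → P ≤ Q → Q + width n ≤ length S → blockAt n S Q ≈± blockAt n S P
  blocks-ordered P Q ∣P ∣Q P≤Q fitsQ with m≤n⇒∃[o]m+o≡n P≤Q
  ... | δ , refl with ∣m+n∣m⇒∣n ∣Q ∣P
  ...   | divides j refl = blocks-along P ∣P j fitsQ

  aligned-blocks : ∀ P Q → X ∣ P → X ∣ Q → P + width n ≤ length S → Q + width n ≤ length S →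
                   blockAt n S Q ≈± blockAt n S P
  aligned-blocks P Q ∣P ∣Q fitsP fitsQ with ≤-total P Q
  ... | inj₁ P≤Q = blocks-ordered P Q ∣P ∣Q P≤Q fitsQ
  ... | inj₂ Q≤P = ≈±-sym (blocks-ordered Q P ∣Q ∣P Q≤P fitsP)

-- A block of length 2^N - 1 starting at a multiple of 2^N is itself
-- N-folding: it agrees up to reversal-negation with the initial block.
aligned-block-folding : ∀ {M S} → Folding M S → ∀ N P → 2 ^ N ∣ P → P + width N ≤ length S →
                        Folding N (blockAt N S P)
aligned-block-folding {M} {S} f N P ∣P fits =
  fold-≈± (fold-prefix f N≤M) (aligned-blocks f N 0 P (divides 0 refl) ∣P (≤-trans (m≤n+m (width N) P) fits) fits)
  where
  2^N≤2^M : 2 ^ N ≤ 2 ^ M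
  2^N≤2^M = subst₂ _≤_ (suc-width N) (fold-suc-length f) (s≤s (≤-trans (m≤n+m (width N) P) fits))
  N≤M : N ≤ M
  N≤M = power-<-cancel (≤-<-trans 2^N≤2^M (^-monoʳ-< 2 (s≤s (s≤s z≤n)) (n<1+n M)))

-- Templates: the shape of a (k+n)-folding sequence over its n-blocks

-- A template is a word of literal signs (inj₁ s) and oriented copies of a
-- block variable G (inj₂ + stands for G, inj₂ - for Ḡ).
Token : Set
Token = Sign ⊎ Sign

orient : Sign → List Sign → List Sign
orient Sg.+ G = G
orient Sg.- G = bar G

orient-opposite : ∀ σ G → orient (opposite σ) G ≡ bar (orient σ G)
orient-opposite Sg.+ G = refl
orient-opposite Sg.- G = sym (bar-bar G)

expand : List Sign → Token → List Sign
expand G (inj₁ s) = [ s ]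
expand G (inj₂ σ) = orient σ G

fill : List Sign → List Token → List Sign
fill G = concatMap (expand G)

barT : List Token → List Token
barT []       = []
barT (t ∷ ts) = barT ts ++ [ Sum.map opposite opposite t ]

fill-barT : ∀ G ts → fill G (barT ts) ≡ bar (fill G ts)
fill-barT G []       = refl
fill-barT G (t ∷ ts) = begin
  fill G (barT ts ++ [ t′ ])            ≡⟨ concatMap-++ (expand G) (barT ts) [ t′ ] ⟩
  fill G (barT ts) ++ expand G t′ ++ [] ≡⟨ cong₂ _++_ (fill-barT G ts) (trans (++-identityʳ _) (expand-flip t)) ⟩
  bar (fill G ts) ++ bar (expand G t)   ≡⟨ sym (bar-++ (expand G t) (fill G ts)) ⟩
  bar (expand G t ++ fill G ts)         ∎
  where
  open ≡-Reasoning
  t′ = Sum.map opposite opposite t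
  expand-flip : ∀ t → expand G (Sum.map opposite opposite t) ≡ bar (expand G t)
  expand-flip (inj₁ s) = refl
  expand-flip (inj₂ σ) = orient-opposite σ G

foldTemplate : List Sign → List Token
foldTemplate []       = [ inj₂ Sg.+ ]
foldTemplate (s ∷ ss) = barT (foldTemplate ss) ++ inj₁ s ∷ foldTemplate ss

decompose : ∀ k {n Y} → Folding (k + n) Y →
            ∃ λ ss → length ss ≡ k × ∃ λ G → Folding n G × Y ≡ fill G (foldTemplate ss)
decompose zero    {Y = Y} f = [] , refl , Y , f , sym (++-identityʳ Y)
decompose (suc k) (foldS {S = Y} s f) with decompose k f
... | ss , refl , G , fG , refl = s ∷ ss , refl , G , fG , (begin
  bar (fill G τ) ++ s ∷ fill G τ            ≡⟨ cong (_++ s ∷ fill G τ) (sym (fill-barT G τ)) ⟩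
  fill G (barT τ) ++ fill G (inj₁ s ∷ τ)    ≡⟨ sym (concatMap-++ (expand G) (barT τ) (inj₁ s ∷ τ)) ⟩
  fill G (barT τ ++ inj₁ s ∷ τ)             ∎)
  where
  open ≡-Reasoning
  τ = foldTemplate ss

formTemplate : Sign → Sign → Sign → List Token
formTemplate σ t s =
  inj₂ (opposite σ) ∷ inj₁ (opposite t) ∷ inj₂ σ ∷ inj₁ s ∷ inj₂ (opposite σ) ∷ inj₁ t ∷ inj₂ σ ∷ []

fill-formTemplate : ∀ G σ t s → fill G (formTemplate σ t s) ≡ Form (orient σ G) t s
fill-formTemplate G σ t s = cong₂ (λ V W → V ++ opposite t ∷ orient σ G ++ s ∷ V ++ t ∷ W)
  (orient-opposite σ G) (++-identityʳ (orient σ G))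

-- A finite check: each of the 32 five-fold templates contains all eight
-- form templates.  (Checked by evaluation.)
∀-sign? : {P : Sign → Set} → (∀ s → Dec (P s)) → Dec (∀ s → P s)
∀-sign? P? = map′ (λ (p , q) → λ { Sg.+ → p ; Sg.- → q }) (λ p → p Sg.+ , p Sg.-) (P? Sg.+ ×-dec P? Sg.-)

five-fold-templates-contain-forms : ∀ s₁ s₂ s₃ s₄ s₅ σ t s →
  Infix _≡_ (formTemplate σ t s) (foldTemplate (s₁ ∷ s₂ ∷ s₃ ∷ s₄ ∷ s₅ ∷ []))
five-fold-templates-contain-forms = from-yes
  (∀-sign? λ s₁ → ∀-sign? λ s₂ → ∀-sign? λ s₃ → ∀-sign? λ s₄ → ∀-sign? λ s₅ →
   ∀-sign? λ σ → ∀-sign? λ t → ∀-sign? λ s →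
   infix? (≡-dec SgP._≟_ SgP._≟_) (formTemplate σ t s) (foldTemplate (s₁ ∷ s₂ ∷ s₃ ∷ s₄ ∷ s₅ ∷ [])))

Occurs : List Sign → List Sign → Set
Occurs U Y = ∃ λ pre → ∃ λ suf → Y ≡ pre ++ U ++ suf

infix-fill : ∀ G {p ts} → Infix _≡_ p ts → Occurs (fill G p) (fill G ts)
infix-fill G {p} inf with toView inf
... | MkView pre {q} p≡q suf = fill G pre , fill G suf , (begin
  fill G (pre ++ q ++ suf)            ≡⟨ concatMap-++ (expand G) pre (q ++ suf) ⟩
  fill G pre ++ fill G (q ++ suf)     ≡⟨ cong (fill G pre ++_) (concatMap-++ (expand G) q suf) ⟩
  fill G pre ++ fill G q ++ fill G suf ≡⟨ cong (λ r → fill G pre ++ fill G r ++ fill G suf) (sym (Pointwise-≡⇒≡ p≡q)) ⟩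
  fill G pre ++ fill G p ++ fill G suf ∎)
  where open ≡-Reasoning

contains-all-forms : ∀ {n Y} → Folding (5 + n) Y →
                     ∃ λ G → Folding n G × (∀ σ t s → Occurs (Form (orient σ G) t s) Y)
contains-all-forms f with decompose 5 f
... | s₁ ∷ s₂ ∷ s₃ ∷ s₄ ∷ s₅ ∷ [] , refl , G , fG , refl = G , fG , λ σ t s →
  subst (λ U → Occurs U _) (fill-formTemplate G σ t s)
    (infix-fill G (five-fold-templates-contain-forms s₁ s₂ s₃ s₄ s₅ σ t s))

module _ (a : ℤ → Sign) where

  length-segment : ∀ x k → length (segment a x k) ≡ k
  length-segment x zero    = refl
  length-segment x (suc k) = cong suc (length-segment _ k)

  at-segment : ∀ x k i → i < k → at (segment a x k) i ≡ a (x ℤ.+ ℤ.+ i)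
  at-segment x (suc k) zero    _       = cong a (sym (ℤP.+-identityʳ x))
  at-segment x (suc k) (suc i) (s≤s p) = trans (at-segment (x ℤ.+ ℤ.+ 1) k i p) (cong a (ℤP.+-assoc x (ℤ.+ 1) (ℤ.+ i)))

  segment-++ : ∀ x k l → segment a x (k + l) ≡ segment a x k ++ segment a (x ℤ.+ ℤ.+ k) l
  segment-++ x zero    l = cong (λ y → segment a y l) (sym (ℤP.+-identityʳ x))
  segment-++ x (suc k) l = cong (a x ∷_) (trans (segment-++ (x ℤ.+ ℤ.+ 1) k l)
    (cong (λ y → segment a (x ℤ.+ ℤ.+ 1) k ++ segment a y l) (ℤP.+-assoc x (ℤ.+ 1) (ℤ.+ k))))

  segment-infix : ∀ x (A U C : List Sign) → segment a x (length (A ++ U ++ C)) ≡ A ++ U ++ C →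
                  segment a (x ℤ.+ ℤ.+ length A) (length U) ≡ U
  segment-infix x A U C eq = proj₁ (++-cancel {xs′ = U} (length-segment _ (length U))
    (trans (sym (segment-++ _ (length U) (length C)))
      (proj₂ (++-cancel {xs′ = A} (length-segment x (length A))
        (trans (sym (segment-++ x (length A) _)) (trans (cong (segment a x) (sym length≡)) eq))))))
    where
    length≡ : length (A ++ U ++ C) ≡ length A + (length U + length C)
    length≡ = trans (length-++ A) (cong (length A +_) (length-++ U))
    ++-cancel : ∀ {xs ys xs′ ys′ : List Sign} → length xs ≡ length xs′ → xs ++ ys ≡ xs′ ++ ys′ → xs ≡ xs′ × ys ≡ ys′
    ++-cancel {[]}     {xs′ = []}      _  eq   = refl , eq
    ++-cancel {x ∷ xs} {xs′ = x′ ∷ xs′} l≡ eq with ∷-injective eq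
    ... | x≡ , rest with ++-cancel {xs} {xs′ = xs′} (suc-injective l≡) rest
    ...   | xs≡ , ys≡ = cong₂ _∷_ x≡ xs≡ , ys≡

  subword-trans : ∀ {U Y} → SubwordZ Y a → Occurs U Y → SubwordZ U a
  subword-trans {U} (y , seg) (pre , suf , refl) = y ℤ.+ ℤ.+ length pre , segment-infix y pre U suf seg

-- Fold points, alignment and blocks of a ℤ-indexed sequence

-- a changes sign across distance 2^(n+1) at c: the mark of a level-n fold point.
Flip : (ℤ → Sign) → ℕ → ℤ → Set
Flip a n c = a (c ℤ.+ ℤ.+ (2 ^ suc n)) ≢ a c

Aligned : (ℤ → Sign) → ℕ → ℤ → Set
Aligned a n d = ∃ λ c → Flip a n c × ℤ.+ (2 ^ n) ∣ℤ (d ℤ.- c)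

block : (ℤ → Sign) → ℕ → ℤ → List Sign
block a n d = segment a (d ℤ.+ ℤ.+ 1) (width n)

common-base : ∀ x y → ∃ λ w → ∃ λ i → ∃ λ j → x ≡ w ℤ.+ ℤ.+ i × y ≡ w ℤ.+ ℤ.+ j
common-base x y = x ℤ.⊓ y , _ , _ , above (ℤP.i⊓j≤i x y) , above (ℤP.i⊓j≤j x y)
  where
  cancel : ∀ w z → w ℤ.+ (z ℤ.- w) ≡ z
  cancel = ℤSolver.solve-∀
  above : ∀ {w z} → w ℤ.≤ z → z ≡ w ℤ.+ ℤ.+ ℤ.∣ z ℤ.- w ∣
  above {w} {z} w≤z = sym (trans (cong (λ k → w ℤ.+ k) (ℤP.0≤i⇒+∣i∣≡i (ℤP.i≤j⇒0≤j-i w≤z))) (cancel w z))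

module _ (X e : ℕ) (w : ℤ) where
  private
    diff≡ : ∀ w e i j → (w ℤ.+ j) ℤ.- (w ℤ.+ i) ≡ (ℤ.+ 1 ℤ.+ (e ℤ.+ j)) ℤ.- (ℤ.+ 1 ℤ.+ (e ℤ.+ i))
    diff≡ = ℤSolver.solve-∀
    sum≡ : ∀ w e i j → ((w ℤ.+ j) ℤ.- (w ℤ.+ i)) ℤ.+ (ℤ.+ 1 ℤ.+ (e ℤ.+ i)) ≡ ℤ.+ 1 ℤ.+ (e ℤ.+ j)
    sum≡ = ℤSolver.solve-∀

  offsets-dvd : ∀ i j → X ∣ suc (e + i) → X ∣ suc (e + j) → ℤ.+ X ∣ℤ ((w ℤ.+ ℤ.+ j) ℤ.- (w ℤ.+ ℤ.+ i))
  offsets-dvd i j ∣i ∣j = ℤ∣.∣⇒∣ᵤ (subst (ℤ∣._∣_ (ℤ.+ X)) (sym (diff≡ w (ℤ.+ e) (ℤ.+ i) (ℤ.+ j)))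
    (ℤ∣.∣m∣n⇒∣m-n (ℤ∣.∣ᵤ⇒∣ {ℤ.+ X} {ℤ.+ suc (e + j)} ∣j) (ℤ∣.∣ᵤ⇒∣ {ℤ.+ X} {ℤ.+ suc (e + i)} ∣i)))

  shift-dvd : ∀ i j → X ∣ suc (e + i) → ℤ.+ X ∣ℤ ((w ℤ.+ ℤ.+ j) ℤ.- (w ℤ.+ ℤ.+ i)) → X ∣ suc (e + j)
  shift-dvd i j ∣i ∣d = ℤ∣.∣⇒∣ᵤ {ℤ.+ X} {ℤ.+ suc (e + j)} (subst (ℤ∣._∣_ (ℤ.+ X)) (sum≡ w (ℤ.+ e) (ℤ.+ i) (ℤ.+ j))
    (ℤ∣.∣m∣n⇒∣m+n (ℤ∣.∣ᵤ⇒∣ {ℤ.+ X} {(w ℤ.+ ℤ.+ j) ℤ.- (w ℤ.+ ℤ.+ i)} ∣d) (ℤ∣.∣ᵤ⇒∣ {ℤ.+ X} {ℤ.+ suc (e + i)} ∣i)))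

-- Windows: finite parts of a complete folding sequence seen inside a
-- finite folding sequence

record Window (a : ℤ → Sign) (w : ℤ) (len : ℕ) : Set where
  field
    level   : ℕ
    host    : List Sign
    offset  : ℕ
    folding : Folding level host
    fits    : offset + len ≤ length host
    agrees  : ∀ i → i < len → a (w ℤ.+ ℤ.+ i) ≡ at host (offset + i)

window : ∀ {a} → CompleteFolding a → ∀ w len → Window a w len
window {a} cf w len with cf (segment a w len) (w , cong (segment a w) (length-segment a w len))
... | M , S , f , e , fits , taken = record
  { level = M ; host = S ; offset = e ; folding = f
  ; fits = subst (λ l → e + l ≤ length S) (length-segment a w len) fits
  ; agrees = λ i i< → let i<′ = subst (i <_) (sym (length-segment a w len)) i< in begin
      a (w ℤ.+ ℤ.+ i)                                       ≡⟨ sym (at-segment a w len i i<) ⟩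
      at (segment a w len) i                                ≡⟨ cong (λ V → at V i) (sym taken) ⟩
      at (take (length (segment a w len)) (drop e S)) i     ≡⟨ at-take _ (drop e S) i<′ ⟩
      at (drop e S) i                                       ≡⟨ at-drop e S i ⟩
      at S (e + i)                                          ∎ }
  where open ≡-Reasoning

module _ {a w len} (W : Window a w len) where
  open Window W

  window-segment : ∀ i m → i + m ≤ len → segment a (w ℤ.+ ℤ.+ i) m ≡ take m (drop (offset + i) host)
  window-segment i m i+m≤ = list-ext _ _ lengths entry
    where
    lengths : length (segment a (w ℤ.+ ℤ.+ i) m) ≡ length (take m (drop (offset + i) host))
    lengths = trans (length-segment a _ m) (sym (length-take-drop m (offset + i) host
                (≤-trans (≤-reflexive (+-assoc offset i m)) (≤-trans (+-monoʳ-≤ offset i+m≤) fits))))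
    entry : ∀ j → j < length (segment a (w ℤ.+ ℤ.+ i) m) → at (segment a (w ℤ.+ ℤ.+ i) m) j ≡ at (take m (drop (offset + i) host)) j
    entry j j<′ = begin
      at (segment a (w ℤ.+ ℤ.+ i) m) j          ≡⟨ at-segment a _ m j j< ⟩
      a (w ℤ.+ ℤ.+ i ℤ.+ ℤ.+ j)                 ≡⟨ cong a (ℤP.+-assoc w (ℤ.+ i) (ℤ.+ j)) ⟩
      a (w ℤ.+ ℤ.+ (i + j))                     ≡⟨ agrees (i + j) (<-≤-trans (+-monoʳ-< i j<) i+m≤) ⟩
      at host (offset + (i + j))                ≡⟨ cong (at host) (sym (+-assoc offset i j)) ⟩
      at host (offset + i + j)                  ≡⟨ sym (at-drop (offset + i) host j) ⟩
      at (drop (offset + i) host) j             ≡⟨ sym (at-take m (drop (offset + i) host) j<) ⟩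
      at (take m (drop (offset + i) host)) j    ∎
      where
      open ≡-Reasoning
      j< : j < m
      j< = subst (j <_) (length-segment a _ m) j<′

  flip-in-window : ∀ n i → i + 2 ^ suc n < len → Flip a n (w ℤ.+ ℤ.+ i) → 2 ^ n ∣ suc (offset + i)
  flip-in-window n i bound flip = flip-at-fold folding n (offset + i) host-bound host-flip
    where
    host-bound : offset + i + 2 ^ suc n < length host
    host-bound = subst (_< length host) (sym (+-assoc offset i _)) (<-≤-trans (+-monoʳ-< offset bound) fits)
    host-flip : at host (offset + i + 2 ^ suc n) ≢ at host (offset + i)
    host-flip eq = flip (begin
      a (w ℤ.+ ℤ.+ i ℤ.+ ℤ.+ (2 ^ suc n))  ≡⟨ cong a (ℤP.+-assoc w (ℤ.+ i) (ℤ.+ (2 ^ suc n))) ⟩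
      a (w ℤ.+ ℤ.+ (i + 2 ^ suc n))        ≡⟨ agrees _ bound ⟩
      at host (offset + (i + 2 ^ suc n))   ≡⟨ cong (at host) (sym (+-assoc offset i _)) ⟩
      at host (offset + i + 2 ^ suc n)     ≡⟨ eq ⟩
      at host (offset + i)                 ≡⟨ sym (agrees i (≤-<-trans (m≤m+n i _) bound)) ⟩
      a (w ℤ.+ ℤ.+ i)                      ∎)
      where open ≡-Reasoning

  block-in-window : ∀ n i → i + 2 ^ n ≤ len → block a n (w ℤ.+ ℤ.+ i) ≡ blockAt n host (suc (offset + i))
  block-in-window n i room = begin
    segment a (w ℤ.+ ℤ.+ i ℤ.+ ℤ.+ 1) (width n)         ≡⟨ cong (λ x → segment a x (width n)) (ℤP.+-assoc w (ℤ.+ i) (ℤ.+ 1)) ⟩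
    segment a (w ℤ.+ ℤ.+ (i + 1)) (width n)             ≡⟨ window-segment (i + 1) (width n) room′ ⟩
    take (width n) (drop (offset + (i + 1)) host)       ≡⟨ cong (λ P → blockAt n host P) (e offset i) ⟩
    blockAt n host (suc (offset + i))                   ∎
    where
    open ≡-Reasoning
    e : ∀ o i → o + (i + 1) ≡ suc (o + i)
    e = solve-∀
    room′ : i + 1 + width n ≤ len
    room′ = subst (_≤ len) (trans (cong (i +_) (sym (suc-width n))) (e′ i (width n))) room
      where e′ : ∀ i b → i + suc b ≡ i + 1 + b
            e′ = solve-∀

  block-fits : ∀ n i → i + 2 ^ n ≤ len → suc (offset + i) + width n ≤ length host
  block-fits n i room = ≤-trans (≤-reflexive (e offset i (width n))) (≤-trans (+-monoʳ-≤ offset room′) fits)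
    where
    e : ∀ o i b → suc (o + i) + b ≡ o + (i + suc b)
    e = solve-∀
    room′ : i + suc (width n) ≤ len
    room′ = subst (λ x → i + x ≤ len) (sym (suc-width n)) room

module _ (a : ℤ → Sign) (cf : CompleteFolding a) (n : ℕ) where
  private
    pair-window : ∀ w i j → Window a w (i + j + suc (2 ^ suc n))
    pair-window w i j = window {a} cf w (i + j + suc (2 ^ suc n))

    room : ∀ i j k → i + k < i + j + suc k
    room i j k = subst (i + k <_) (e i j k) (s≤s (m≤m+n (i + k) j))
      where e : ∀ i j k → suc (i + k + j) ≡ i + j + suc k
            e = solve-∀

    room′ : ∀ i j k → j + k < i + j + suc k
    room′ i j k = subst (j + k <_) (cong (_+ suc k) (+-comm j i)) (room j i k)

    block-room : ∀ {i l} → i + 2 ^ suc n < l → i + 2 ^ n ≤ l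
    block-room {i} lt = ≤-trans (+-monoʳ-≤ i (^-monoʳ-≤ 2 (n≤1+n n))) (<⇒≤ lt)

  flips-congruent : ∀ c c′ → Flip a n c → Flip a n c′ → ℤ.+ (2 ^ n) ∣ℤ (c′ ℤ.- c)
  flips-congruent c c′ flip flip′ with common-base c c′
  ... | w , i , j , refl , refl = offsets-dvd (2 ^ n) offset w i j
      (flip-in-window W n i (room i j _) flip) (flip-in-window W n j (room′ i j _) flip′)
    where
    W = pair-window w i j
    open Window W

  block-near-flip : ∀ c d → Flip a n c → ℤ.+ (2 ^ n) ∣ℤ (d ℤ.- c) → block a n d ≈± block a n c
  block-near-flip c d flip d∣ with common-base c d
  ... | w , i , j , refl , refl =
    subst₂ _≈±_ (sym (block-in-window W n j (block-room (room′ i j _)))) (sym (block-in-window W n i (block-room (room i j _))))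
      (aligned-blocks folding n (suc (offset + i)) (suc (offset + j)) ∣c ∣d
        (block-fits W n i (block-room (room i j _))) (block-fits W n j (block-room (room′ i j _))))
    where
    W = pair-window w i j
    open Window W
    ∣c : 2 ^ n ∣ suc (offset + i)
    ∣c = flip-in-window W n i (room i j _) flip
    ∣d : 2 ^ n ∣ suc (offset + j)
    ∣d = shift-dvd (2 ^ n) offset w i j ∣c d∣

  aligned-related : ∀ d d′ → Aligned a n d → Aligned a n d′ → block a n d ≈± block a n d′
  aligned-related d d′ (c , flip , d∣) (c′ , flip′ , d′∣) =
    ≈±-trans (block-near-flip c d flip d∣)
      (≈±-trans (≈±-sym (block-near-flip c c′ flip (flips-congruent c c′ flip flip′)))
                (≈±-sym (block-near-flip c′ d′ flip′ d′∣)))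

  flip-aligned : ∀ c → Flip a n c → Aligned a n c
  flip-aligned c flip = c , flip , subst (ℤ.+ (2 ^ n) ∣ℤ_) (sym (ℤP.+-inverseʳ c)) (divides 0 refl)

module _ (a : ℤ → Sign) where

  read-at : ∀ x A y C → segment a x (length (A ++ y ∷ C)) ≡ A ++ y ∷ C → a (x ℤ.+ ℤ.+ length A) ≡ y
  read-at x A y C seg = proj₁ (∷-injective (segment-infix a x A [ y ] C seg))

  module _ (n : ℕ) (p : ℤ) (W : List Sign) (t s : Sign) (|W| : length W ≡ width n)
           (seg : segment a p (length (Form W t s)) ≡ Form W t s) where
    private
      B = width n
      |bar-W| : length (bar W) ≡ B
      |bar-W| = trans (length-bar W) |W|

    -- The entries -t and t of the form lie 2^(n+1) apart starting at
    -- p + 2^n - 1, which is therefore a fold point.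
    form-flip : Flip a n (p ℤ.+ ℤ.+ width n)
    form-flip eq = s≢opposite[s] t (trans (sym at-B+) (trans eq at-B))
      where
      at-B : a (p ℤ.+ ℤ.+ B) ≡ opposite t
      at-B = subst (λ k → a (p ℤ.+ ℤ.+ k) ≡ opposite t) |bar-W| (read-at p (bar W) (opposite t) _ seg)
      A = bar W ++ opposite t ∷ W ++ s ∷ bar W
      split≡ : Form W t s ≡ A ++ t ∷ W
      split≡ = sym (trans (++-assoc (bar W) _ (t ∷ W)) (cong (λ V → bar W ++ opposite t ∷ V) (++-assoc W (s ∷ bar W) (t ∷ W))))
      e : ∀ B → suc (B + suc B) ≡ suc B + (suc B + 0)
      e = solve-∀
      |A| : length A ≡ B + 2 ^ suc n
      |A| = begin
        length A                                               ≡⟨ length-++ (bar W) ⟩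
        length (bar W) + suc (length (W ++ s ∷ bar W))         ≡⟨ cong (λ l → length (bar W) + suc l) (length-++ W) ⟩
        length (bar W) + suc (length W + suc (length (bar W))) ≡⟨ cong₂ (λ x y → x + suc (y + suc x)) |bar-W| |W| ⟩
        B + suc (B + suc B)                                    ≡⟨ cong (B +_) (e B) ⟩
        B + (suc B + (suc B + 0))                              ≡⟨ cong (λ x → B + (x + (x + 0))) (suc-width n) ⟩
        B + 2 ^ suc n                                          ∎
        where open ≡-Reasoning
      at-B+ : a (p ℤ.+ ℤ.+ B ℤ.+ ℤ.+ (2 ^ suc n)) ≡ t
      at-B+ = trans (cong a (ℤP.+-assoc p (ℤ.+ B) _)) (subst (λ k → a (p ℤ.+ ℤ.+ k) ≡ t) |A|
                (read-at p A t W (subst (λ V → segment a p (length V) ≡ V) split≡ seg)))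

    form-block : block a n (p ℤ.+ ℤ.+ width n) ≡ W
    form-block = begin
      segment a (p ℤ.+ ℤ.+ B ℤ.+ ℤ.+ 1) (width n) ≡⟨ cong₂ (segment a) (trans (ℤP.+-assoc p (ℤ.+ B) (ℤ.+ 1)) (cong (λ k → p ℤ.+ ℤ.+ k) (sym |A|))) (sym |W|) ⟩
      segment a (p ℤ.+ ℤ.+ length A) (length W)   ≡⟨ segment-infix a p A W _ (subst (λ V → segment a p (length V) ≡ V) (sym (++-assoc (bar W) [ opposite t ] _)) seg) ⟩
      W                                           ∎
      where
      open ≡-Reasoning
      A = bar W ++ [ opposite t ]
      |A| : length A ≡ B + 1
      |A| = trans (length-++ (bar W)) (cong (_+ 1) |bar-W|)

-- A complete folding sequence has K-folding subwords for every K: inside a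
-- window of length 2^(K+1), take the host block at the next multiple of 2^K.
folding-subword : ∀ {a} → CompleteFolding a → ∀ K → ∃ λ Y → Folding K Y × SubwordZ Y a
folding-subword {a} cf K = blockAt K host P , aligned-block-folding folding K P ∣P fitsP , ℤ.+ 0 ℤ.+ ℤ.+ o , seg
  where
  X = 2 ^ K
  instance
    X-nonzero : ℕ.NonZero X
    X-nonzero = m^n≢0 2 K
  W = window {a} cf (ℤ.+ 0) (X + X)
  open Window W
  r = offset % X
  o = X ∸ r
  P = offset + o
  P≡ : P ≡ suc (offset / X) * X
  P≡ = begin
    offset + (X ∸ r)                            ≡⟨ cong (_+ (X ∸ r)) (m≡m%n+[m/n]*n offset X) ⟩
    r + offset / X * X + (X ∸ r)                ≡⟨ e r (offset / X * X) (X ∸ r) ⟩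
    offset / X * X + (r + (X ∸ r))              ≡⟨ cong (offset / X * X +_) (m+[n∸m]≡n (<⇒≤ (m%n<n offset X))) ⟩
    offset / X * X + X                          ≡⟨ +-comm _ X ⟩
    suc (offset / X) * X                        ∎
    where
    open ≡-Reasoning
    e : ∀ r m x → r + m + x ≡ m + (r + x)
    e = solve-∀
  ∣P : X ∣ P
  ∣P = divides (suc (offset / X)) P≡
  room : o + width K ≤ X + X
  room = +-mono-≤ (m∸n≤m X r) (≤-trans (n≤1+n _) (≤-reflexive (suc-width K)))
  fitsP : P + width K ≤ length host
  fitsP = ≤-trans (≤-reflexive (+-assoc offset o _)) (≤-trans (+-monoʳ-≤ offset room) fits)
  seg : segment a (ℤ.+ 0 ℤ.+ ℤ.+ o) (length (blockAt K host P)) ≡ blockAt K host P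
  seg = trans (cong (segment a _) (length-blockAt K host P fitsP)) (window-segment W o (width K) room)

-- The position h of the statement is aligned: IsHn at k = 1 says h_n is a fold point.
InE-aligned : ∀ {a n h} → InE a n h → Aligned a n h
InE-aligned {a} {n} (h′ , isHn , h∣) = h′ , flip , h∣
  where
  flip : Flip a n h′
  flip eq = s≢opposite[s] (a h′) (trans (sym eq)
              (trans (cong (λ k → a (h′ ℤ.+ k)) (sym (ℤP.*-identityˡ (ℤ.+ (2 ^ suc n))))) (isHn (ℤ.+ 1))))

≈±-orient : ∀ {V G} → V ≈± G → ∃ λ σ → V ≡ orient σ G
≈±-orient (inj₁ V≡) = Sg.+ , V≡
≈±-orient (inj₂ V≡) = Sg.- , V≡

Shapes : List Sign → List Sign → Set
Shapes T U = ∃ λ (ζ : Sign) → ∃ λ (η : Sign) →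
  (U ≡ bar T ++ (opposite ζ ∷ T) ++ (η ∷ bar T) ++ (ζ ∷ T))
  ⊎ (U ≡ T ++ (opposite ζ ∷ bar T) ++ (η ∷ T) ++ (ζ ∷ bar T))

Form-bar : ∀ T ζ η → Form (bar T) ζ η ≡ T ++ (opposite ζ ∷ bar T) ++ (η ∷ T) ++ (ζ ∷ bar T)
Form-bar T ζ η = cong (λ V → V ++ opposite ζ ∷ bar T ++ η ∷ V ++ ζ ∷ bar T) (bar-bar T)

module _ (a : ℤ → Sign) (cf : CompleteFolding a) (n : ℕ) (h : ℤ) (h-aligned : Aligned a n h) where
  private
    T = block a n h

  -- The block W of any occurrence of a form Form W t s in a follows a fold
  -- point of a, so it is related to the block T after h.
  form-block-related : ∀ p W t s → length W ≡ width n → segment a p (length (Form W t s)) ≡ Form W t s → W ≈± T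
  form-block-related p W t s |W| seg = subst (_≈± T) (form-block a n p W t s |W| seg)
    (aligned-related a cf n (p ℤ.+ ℤ.+ width n) h (flip-aligned a cf n _ (form-flip a n p W t s |W| seg)) h-aligned)

  subword-shape : ∀ {U} → Folding (suc (suc n)) U → SubwordZ U a → Shapes T U
  subword-shape fU (p , seg) with folding-form fU
  ... | W , t , s , fW , refl with form-block-related p W t s (fold-length fW) seg
  ...   | inj₁ refl = t , s , inj₁ refl
  ...   | inj₂ refl = t , s , inj₂ (Form-bar T t s)

  -- Conversely, an (n+5)-folding subword Y of a contains every form over
  -- its block G, and G ≈± T; so every Form V ζ η with V ≈± T occurs in Y.
  form-subword : ∀ {V} → V ≈± T → ∀ ζ η → SubwordZ (Form V ζ η) a
  form-subword V≈T ζ η with folding-subword {a} cf (5 + n)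
  ... | Y , fY , Y-sub with contains-all-forms fY
  ...   | G , fG , occurs with subword-trans a Y-sub (occurs Sg.+ Sg.+ Sg.+)
  ...     | p , seg with ≈±-orient (≈±-trans V≈T (≈±-sym (form-block-related p G Sg.+ Sg.+ (fold-length fG) seg)))
  ...       | σ , refl = subword-trans a Y-sub (occurs σ ζ η)

  shape-subword : ∀ {U} → Shapes T U → SubwordZ U a
  shape-subword (ζ , η , inj₁ refl) = form-subword ≈±-refl ζ η
  shape-subword (ζ , η , inj₂ refl) = subst (λ V → SubwordZ V a) (Form-bar T ζ η) (form-subword (inj₂ refl) ζ η)

corollary1p7 : (a : ℤ → Sign) → CompleteFolding a → (n : ℕ) → (h : ℤ) → InE a n h →
    let T = segment a (h ℤ.+ ℤ.+ 1) (2 ^ n ∸ 1) in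
    (U : List Sign) → Folding (n + 2) U →
    (SubwordZ U a ⇔
      (∃ λ (ζ : Sign) → ∃ λ (η : Sign) →
        (U ≡ bar T ++ (opposite ζ ∷ T) ++ (η ∷ bar T) ++ (ζ ∷ T))
        ⊎ (U ≡ T ++ (opposite ζ ∷ bar T) ++ (η ∷ T) ++ (ζ ∷ bar T))))
corollary1p7 a cf n h h∈E U fU =
  mk⇔ (subword-shape a cf n h h-aligned (subst (λ k → Folding k U) (+-comm n 2) fU))
      (shape-subword a cf n h h-aligned)
  where
  h-aligned : Aligned a n h
  h-aligned = InE-aligned {a} {n} {h} h∈E
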